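{- Let $T\cong\mathrm{Alt}_n$ with $n\ge 5$. Then: (1) if $n\ge16$, there is $x\in T\setminus\{1\}$ with $|C_T(x)|>|T|^{3/4}$; (2) if $n\ge 8$, there is $x\in T\setminus\{1\}$ with $|C_T(x)|>|T|^{1/2}$; (3) there is $x\in T\setminus\{1\}$ with $|C_T(x)|>|T|^{1/4}$.
   Context: $\mathrm{Alt}_n$ is the alternating group of degree $n$. -}

module Defs where

open import Data.Bool using (Bool; true; false; not; _∧_)
open import Data.Nat using (ℕ; zero; suc; _+_; _%_; _≡ᵇ_; _<ᵇ_)
open import Data.Fin using (Fin; toℕ; _≟_)
open import Data.List using (List; []; _∷_; [_]; map; concatMap; filterᵇ; length)
open import Data.List.Membership.Propositional using (_∈_)
open import Data.Vec using (Vec; []; _∷_; lookup; allFin)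
import Data.Vec
open import Data.Vec.Properties using (≡-dec)
open import Data.Fin using (_≟_)
open import Relation.Nullary.Decidable using (⌊_⌋)

-- Permutations of {0,…,n-1} are encoded as vectors v of length n with
-- distinct entries; v represents the map i ↦ lookup v i.

allVecs : (n k : ℕ) → List (Vec (Fin n) k)
allVecs n zero = [ [] ]
allVecs n (suc k) = concatMap (λ i → map (i ∷_) (allVecs n k)) (Data.List.allFin n)

elemB : {n : ℕ} → Fin n → {m : ℕ} → Vec (Fin n) m → Bool
elemB x [] = false
elemB x (y ∷ ys) = ⌊ x ≟ y ⌋ Data.Bool.∨ elemB x ys

distinctB : {n m : ℕ} → Vec (Fin n) m → Bool
distinctB [] = true
distinctB (x ∷ xs) = not (elemB x xs) ∧ distinctB xs

countSmaller : {n m : ℕ} → Fin n → Vec (Fin n) m → ℕ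
countSmaller x [] = 0
countSmaller x (y ∷ ys) = (if toℕ y <ᵇ toℕ x then 1 else 0) + countSmaller x ys
  where open import Data.Bool using (if_then_else_)

inversions : {n m : ℕ} → Vec (Fin n) m → ℕ
inversions [] = 0
inversions (x ∷ xs) = countSmaller x xs + inversions xs

evenB : {n m : ℕ} → Vec (Fin n) m → Bool
evenB v = (inversions v % 2) ≡ᵇ 0

Alt : (n : ℕ) → List (Vec (Fin n) n)
Alt n = filterᵇ (λ v → distinctB v ∧ evenB v) (allVecs n n)

idPerm : (n : ℕ) → Vec (Fin n) n
idPerm n = allFin n

_∘ₚ_ : {n : ℕ} → Vec (Fin n) n → Vec (Fin n) n → Vec (Fin n) n
σ ∘ₚ τ = Data.Vec.map (lookup σ) τ

commutesB : {n : ℕ} → Vec (Fin n) n → Vec (Fin n) n → Bool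
commutesB x y = ⌊ ≡-dec _≟_ (x ∘ₚ y) (y ∘ₚ x) ⌋

orderAlt : ℕ → ℕ
orderAlt n = length (Alt n)

centralizerSize : {n : ℕ} → Vec (Fin n) n → ℕ
centralizerSize {n} x = length (filterᵇ (commutesB x) (Alt n))

-- The 3-cycle σ = (0 1 2) in Alt n, n = 3 + k, commutes with every even permutation acting on
-- {0, 1, 2} as a power of σ and on the remaining k points as an even permutation.  These are 3e
-- elements of its centralizer, where e = k!/2, while |Alt n| = (k+3)(k+2)(k+1)·e.  Both halvings
-- come from one count: the injective k-tuples avoiding m given points number k! when m + k = n,
-- and exchanging the first two entries of such a tuple flips its parity.  With P = (k+3)(k+2)(k+1)
-- the three claims reduce to 2P³ < 81·k!, 2P < 9·k! and 8P < 81·(k!)³, which persist from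
-- k = 13, 5 and 2 on because the left sides grow by a factor of at most k + 1 per step.
module Submission where

open import Defs
open import Data.Nat using (ℕ; _≤_; _<_; _^_)
open import Data.Fin using (Fin)
open import Data.Vec using (Vec)
open import Data.Product using (_×_; ∃-syntax)
open import Data.List.Membership.Propositional using (_∈_)
open import Relation.Binary.PropositionalEquality using (_≢_)

open import Level using (Level)
open import Algebra.Bundles using (CommutativeMonoid)
import Algebra.Properties.CommutativeSemigroup as CommSemigroupProperties
open import Data.Bool.Base using (Bool; true; false; not; _∧_; _∨_; if_then_else_)
open import Data.Bool.Properties
  using (T?; T-≡; ∧-commutativeMonoid; ∧-identityʳ; ∧-conicalˡ; ∧-conicalʳ; not-involutive)
open import Data.Fin.Base using (zero; suc; toℕ; _↑ʳ_)
open import Data.Fin.Patterns using (0F; 1F; 2F)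
open import Data.Fin.Properties using (_≟_; <-cmp; <⇒≢)
open import Data.List.Base using (List; []; _∷_; map; concatMap; filterᵇ; length; _++_; allFin; tabulate)
open import Data.List.Properties using (map-tabulate; length-tabulate)
open import Data.List.Membership.Propositional.Properties using (∈-map⁺; ∈-concat⁺′; ∈-allFin; ∈-filter⁺)
open import Data.List.Relation.Unary.Any using (here)
open import Data.Nat.Base
  using (zero; suc; _+_; _*_; _%_; _≡ᵇ_; _<ᵇ_; _!; NonZero; s≤s; z≤n; z<s; s<s; _≤′_; ≤′-step; ≤′-reflexive)
open import Data.Nat.Combinatorics using (_P_)
import Data.Nat.ListAction as List
open import Data.Nat.Properties
  using (+-0-commutativeMonoid; +-commutativeSemigroup; *-commutativeSemigroup; +-identityʳ; +-suc;
         +-cancelˡ-≡; *-cancelˡ-≡; *-cancelˡ-<; ≤-trans; ≤-reflexive; ≤-<-trans; <⇒≯; m≤m+n; m≤n⇒m≤1+n;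
         m≤m*n; +-monoʳ-≤; +-mono-≤; *-monoˡ-≤; *-monoʳ-≤; *-monoˡ-<; *-monoʳ-<; ^-monoˡ-≤; m^n≢0;
         m*n≢0⇒n≢0; <ᵇ⇒<; ≤⇒≤′; ≤′⇒≤; _!≢0; module ≤-Reasoning)
  renaming (_<?_ to _<ℕ?_)
open import Data.Nat.Tactic.RingSolver using (solve-∀)
open import Data.Product using (_,_)
open import Data.Vec.Base as Vec using ([]; _∷_; lookup)
open import Data.Vec.Properties using (≡-dec; lookup∘tabulate; tabulate∘lookup; tabulate-∘)
open import Data.Vec.Relation.Unary.All as All using (All; []; _∷_)
open import Data.Vec.Relation.Unary.All.Properties using () renaming (tabulate⁺ to All-tabulate⁺)
open import Data.Vec.Relation.Unary.AllPairs using (AllPairs; []; _∷_)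
open import Function.Base using (_∘_; id)
open import Function.Bundles using (Equivalence)
open import Relation.Binary.Definitions using (tri<; tri≈; tri>)
open import Relation.Binary.PropositionalEquality
  using (_≡_; refl; sym; trans; cong; cong₂; subst; _≗_; module ≡-Reasoning)
open import Relation.Nullary.Decidable using (Dec; ⌊_⌋; yes; no; dec-true; dec-false; isYes≗does; ⌊⌋-map′)
open import Relation.Nullary.Negation using (¬_)

open import Algebra.Properties.CommutativeMonoid.Sum +-0-commutativeMonoid
  using (sum-syntax; sum-cong-≗; sum-remove; ∑-comm)

private
  variable
    a : Level
    A B : Set a
    n m k j : ℕ

  module ∧ = CommSemigroupProperties (CommutativeMonoid.commutativeSemigroup ∧-commutativeMonoid)
  module + = CommSemigroupProperties +-commutativeSemigroup
  module * = CommSemigroupProperties *-commutativeSemigroup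

-- Counting with Boolean predicates

count : (A → Bool) → List A → ℕ
count p []       = 0
count p (x ∷ xs) = if p x then suc (count p xs) else count p xs

length-filterᵇ : (p : A → Bool) (xs : List A) → length (filterᵇ p xs) ≡ count p xs
length-filterᵇ p []       = refl
length-filterᵇ p (x ∷ xs) with p x
... | true  = cong suc (length-filterᵇ p xs)
... | false = length-filterᵇ p xs

count-filterᵇ : (p q : A → Bool) (xs : List A) →
                count q (filterᵇ p xs) ≡ count (λ x → p x ∧ q x) xs
count-filterᵇ p q []       = refl
count-filterᵇ p q (x ∷ xs) with p x
... | true  = cong (λ c → if q x then suc c else c) (count-filterᵇ p q xs)
... | false = count-filterᵇ p q xs

count-cong : {p q : A → Bool} → p ≗ q → (xs : List A) → count p xs ≡ count q xs
count-cong p≗q []       = refl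
count-cong {q = q} p≗q (x ∷ xs) rewrite p≗q x =
  cong (λ c → if q x then suc c else c) (count-cong p≗q xs)

count-mono : {p q : A → Bool} → (∀ x → p x ≡ true → q x ≡ true) →
             (xs : List A) → count p xs ≤ count q xs
count-mono p⇒q [] = z≤n
count-mono {p = p} {q} p⇒q (x ∷ xs) with p x | q x | p⇒q x
... | true  | true  | _   = s≤s (count-mono p⇒q xs)
... | true  | false | px⇒qx with () ← px⇒qx refl
... | false | true  | _   = m≤n⇒m≤1+n (count-mono p⇒q xs)
... | false | false | _   = count-mono p⇒q xs

count-false : (xs : List A) → count (λ _ → false) xs ≡ 0
count-false []       = refl
count-false (_ ∷ xs) = count-false xs

count-true : (xs : List A) → count (λ _ → true) xs ≡ length xs
count-true []       = refl
count-true (_ ∷ xs) = cong suc (count-true xs)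

count-∧-not : (p q : A → Bool) (xs : List A) →
              count (λ x → p x ∧ q x) xs + count (λ x → p x ∧ not (q x)) xs ≡ count p xs
count-∧-not p q []       = refl
count-∧-not p q (x ∷ xs) with p x | q x
... | true  | true  = cong suc (count-∧-not p q xs)
... | true  | false = trans (+-suc _ _) (cong suc (count-∧-not p q xs))
... | false | _     = count-∧-not p q xs

count-∨ : (p q : A → Bool) → (∀ x → p x ∧ q x ≡ false) → (xs : List A) →
          count (λ x → p x ∨ q x) xs ≡ count p xs + count q xs
count-∨ p q disjoint []       = refl
count-∨ p q disjoint (x ∷ xs) with p x | q x | disjoint x
... | true  | true  | ()
... | true  | false | _ = cong suc (count-∨ p q disjoint xs)
... | false | true  | _ = trans (cong suc (count-∨ p q disjoint xs)) (sym (+-suc _ _))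
... | false | false | _ = count-∨ p q disjoint xs

count-++ : (p : A → Bool) (xs ys : List A) → count p (xs ++ ys) ≡ count p xs + count p ys
count-++ p []       ys = refl
count-++ p (x ∷ xs) ys with p x
... | true  = cong suc (count-++ p xs ys)
... | false = count-++ p xs ys

count-map : (p : B → Bool) (f : A → B) (xs : List A) → count p (map f xs) ≡ count (p ∘ f) xs
count-map p f []       = refl
count-map p f (x ∷ xs) = cong (λ c → if p (f x) then suc c else c) (count-map p f xs)

count-concatMap : (p : B → Bool) (f : A → List B) (xs : List A) →
                  count p (concatMap f xs) ≡ List.sum (map (count p ∘ f) xs)
count-concatMap p f []       = refl
count-concatMap p f (x ∷ xs) =
  trans (count-++ p (f x) (concatMap f xs)) (cong (count p (f x) +_) (count-concatMap p f xs))

sum-map-if : (p : A → Bool) (c : ℕ) (xs : List A) →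
             List.sum (map (λ x → if p x then c else 0) xs) ≡ count p xs * c
sum-map-if p c []       = refl
sum-map-if p c (x ∷ xs) with p x
... | true  = cong (c +_) (sum-map-if p c xs)
... | false = sum-map-if p c xs

sum-tabulate : (f : Fin n → ℕ) → List.sum (tabulate f) ≡ ∑[ i < n ] f i
sum-tabulate {zero}  f = refl
sum-tabulate {suc n} f = cong (f 0F +_) (sum-tabulate (f ∘ suc))

sum-map-allFin : (f : Fin n → ℕ) → List.sum (map f (allFin n)) ≡ ∑[ i < n ] f i
sum-map-allFin f = trans (cong List.sum (map-tabulate id f)) (sum-tabulate f)

∑-indicator : (p : Fin n → Bool) (c : ℕ) → ∑[ i < n ] (if p i then c else 0) ≡ count p (allFin n) * c
∑-indicator {n} p c = trans (sym (sum-map-allFin (λ i → if p i then c else 0))) (sum-map-if p c (allFin n))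

term≤∑ : (f : Fin n → ℕ) (i : Fin n) → f i ≤ ∑[ j < n ] f j
term≤∑ {suc n} f i = ≤-trans (m≤m+n (f i) _) (≤-reflexive (sym (sum-remove {i = i} f)))

count-allVecs-suc : (p : Vec (Fin n) (suc k) → Bool) →
                    count p (allVecs n (suc k)) ≡ ∑[ i < n ] count (p ∘ (i ∷_)) (allVecs n k)
count-allVecs-suc {n} {k} p = begin
  count p (allVecs n (suc k))
    ≡⟨ count-concatMap p (λ i → map (i ∷_) (allVecs n k)) (allFin n) ⟩
  List.sum (map (λ i → count p (map (i ∷_) (allVecs n k))) (allFin n))
    ≡⟨ sum-map-allFin (λ i → count p (map (i ∷_) (allVecs n k))) ⟩
  ∑[ i < n ] count p (map (i ∷_) (allVecs n k))
    ≡⟨ sum-cong-≗ (λ i → count-map p (i ∷_) (allVecs n k)) ⟩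
  ∑[ i < n ] count (p ∘ (i ∷_)) (allVecs n k) ∎
  where open ≡-Reasoning

count-allVecs-head : (p : Vec (Fin n) (suc k) → Bool) (i : Fin n) →
                     count (p ∘ (i ∷_)) (allVecs n k) ≤ count p (allVecs n (suc k))
count-allVecs-head {n} {k} p i =
  ≤-trans (term≤∑ (λ j → count (p ∘ (j ∷_)) (allVecs n k)) i) (≤-reflexive (sym (count-allVecs-suc p)))

∈-allVecs : (v : Vec (Fin n) k) → v ∈ allVecs n k
∈-allVecs []                  = here refl
∈-allVecs {n} {suc k} (i ∷ v) =
  ∈-concat⁺′ (∈-map⁺ (i ∷_) (∈-allVecs v)) (∈-map⁺ (λ j → map (j ∷_) (allVecs n k)) (∈-allFin i))

count-tabulate-suc : (p : Fin (suc n) → Bool) → count p (tabulate suc) ≡ count (λ i → p (suc i)) (allFin n)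
count-tabulate-suc {n} p = trans (cong (count p) (sym (map-tabulate id suc))) (count-map p suc (allFin n))

count-≟ : (a : Fin n) → count (λ i → ⌊ i ≟ a ⌋) (allFin n) ≡ 1
count-≟ {suc n} 0F      = cong suc (trans (count-tabulate-suc {n} (λ i → ⌊ i ≟ 0F ⌋)) (count-false (allFin n)))
count-≟ {suc n} (suc a) = begin
  count (λ i → ⌊ i ≟ suc a ⌋) (tabulate suc)  ≡⟨ count-tabulate-suc {n} (λ i → ⌊ i ≟ suc a ⌋) ⟩
  count (λ i → ⌊ suc i ≟ suc a ⌋) (allFin n) ≡⟨ count-cong (λ i → ⌊⌋-map′ _ _ (i ≟ a)) (allFin n) ⟩
  count (λ i → ⌊ i ≟ a ⌋) (allFin n)         ≡⟨ count-≟ a ⟩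
  1                                           ∎
  where open ≡-Reasoning

count-elemB : (S : Vec (Fin n) m) → distinctB S ≡ true → count (λ i → elemB i S) (allFin n) ≡ m
count-elemB {n} []      _            = count-false (allFin n)
count-elemB {n} (a ∷ S) a∷S-distinct =
  trans (count-∨ (λ i → ⌊ i ≟ a ⌋) (λ i → elemB i S) disjoint (allFin n))
        (cong₂ _+_ (count-≟ a) (count-elemB S (∧-conicalʳ _ _ a∷S-distinct)))
  where
  disjoint : ∀ i → ⌊ i ≟ a ⌋ ∧ elemB i S ≡ false
  disjoint i with i ≟ a
  ... | yes refl = trans (sym (not-involutive _)) (cong not (∧-conicalˡ _ _ a∷S-distinct))
  ... | no _     = refl

count-not-elemB : (S : Vec (Fin n) m) → distinctB S ≡ true →
                m + count (λ i → not (elemB i S)) (allFin n) ≡ n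
count-not-elemB {n} {m} S S-distinct = begin
  m + count (λ i → not (elemB i S)) (allFin n)
    ≡⟨ cong (_+ count (λ i → not (elemB i S)) (allFin n)) (count-elemB S S-distinct) ⟨
  count (λ i → elemB i S) (allFin n) + count (λ i → not (elemB i S)) (allFin n)
    ≡⟨ count-∧-not (λ _ → true) (λ i → elemB i S) (allFin n) ⟩
  count (λ _ → true) (allFin n)
    ≡⟨ count-true (allFin n) ⟩
  length (allFin n)
    ≡⟨ length-tabulate id ⟩
  n ∎
  where open ≡-Reasoning

-- Injective tuples avoiding a set of points, and their parity

⌊⌋-true : (a? : Dec A) → A → ⌊ a? ⌋ ≡ true
⌊⌋-true a? a = trans (isYes≗does a?) (dec-true a? a)

⌊⌋-false : (a? : Dec A) → ¬ A → ⌊ a? ⌋ ≡ false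
⌊⌋-false a? ¬a = trans (isYes≗does a?) (dec-false a? ¬a)

avoidsB : Vec (Fin n) m → Vec (Fin n) k → Bool
avoidsB S []      = true
avoidsB S (x ∷ w) = not (elemB x S) ∧ avoidsB S w

freshB : Vec (Fin n) m → Vec (Fin n) k → Bool
freshB S w = distinctB w ∧ avoidsB S w

avoidsB-[] : (w : Vec (Fin n) k) → avoidsB [] w ≡ true
avoidsB-[] []      = refl
avoidsB-[] (_ ∷ w) = avoidsB-[] w

avoidsB-cons : (i : Fin n) (S : Vec (Fin n) m) (w : Vec (Fin n) k) →
               avoidsB (i ∷ S) w ≡ not (elemB i w) ∧ avoidsB S w
avoidsB-cons i S []      = refl
avoidsB-cons i S (x ∷ w) with x ≟ i
... | yes refl rewrite ⌊⌋-true (x ≟ x) refl = refl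
... | no x≢i   rewrite ⌊⌋-false (i ≟ x) (x≢i ∘ sym) | avoidsB-cons i S w =
  ∧.x∙yz≈y∙xz (not (elemB x S)) (not (elemB i w)) (avoidsB S w)

freshB-cons : (i : Fin n) (S : Vec (Fin n) m) (w : Vec (Fin n) k) →
              freshB S (i ∷ w) ≡ not (elemB i S) ∧ freshB (i ∷ S) w
freshB-cons i S w = begin
  (i∉w ∧ distinctB w) ∧ (i∉S ∧ avoidsB S w) ≡⟨ ∧.x∙yz≈y∙xz (i∉w ∧ distinctB w) i∉S (avoidsB S w) ⟩
  i∉S ∧ ((i∉w ∧ distinctB w) ∧ avoidsB S w) ≡⟨ cong (i∉S ∧_) (∧.xy∙z≈y∙xz i∉w (distinctB w) (avoidsB S w)) ⟩
  i∉S ∧ (distinctB w ∧ (i∉w ∧ avoidsB S w)) ≡⟨ cong (λ b → i∉S ∧ (distinctB w ∧ b)) (avoidsB-cons i S w) ⟨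
  i∉S ∧ (distinctB w ∧ avoidsB (i ∷ S) w)   ∎
  where
  open ≡-Reasoning
  i∉w i∉S : Bool
  i∉w = not (elemB i w)
  i∉S = not (elemB i S)

count-freshB : (S : Vec (Fin n) m) → distinctB S ≡ true → (k : ℕ) → m + k ≡ n →
               count (freshB S) (allVecs n k) ≡ k !
count-freshB S S-distinct zero    _        = refl
count-freshB {n} {m} S S-distinct (suc k) m+1+k≡n = begin
  count (freshB S) (allVecs n (suc k))
    ≡⟨ count-allVecs-suc (freshB S) ⟩
  ∑[ i < n ] count (freshB S ∘ (i ∷_)) (allVecs n k)
    ≡⟨ sum-cong-≗ extend ⟩
  ∑[ i < n ] (if not (elemB i S) then k ! else 0)
    ≡⟨ ∑-indicator (λ i → not (elemB i S)) (k !) ⟩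
  count (λ i → not (elemB i S)) (allFin n) * k !
    ≡⟨ cong (_* k !) outside ⟩
  suc k * k ! ∎
  where
  open ≡-Reasoning
  outside : count (λ i → not (elemB i S)) (allFin n) ≡ suc k
  outside = +-cancelˡ-≡ m _ _ (trans (count-not-elemB S S-distinct) (sym m+1+k≡n))
  extend : ∀ i → count (freshB S ∘ (i ∷_)) (allVecs n k) ≡ (if not (elemB i S) then k ! else 0)
  extend i rewrite count-cong (freshB-cons i S) (allVecs n k) with elemB i S in i∈S
  ... | true  = count-false (allVecs n k)
  ... | false = count-freshB (i ∷ S) (trans (cong (λ b → not b ∧ distinctB S) i∈S) S-distinct) k
                             (trans (sym (+-suc m k)) m+1+k≡n)

parity-suc : ∀ x → (suc x % 2 ≡ᵇ 0) ≡ not (x % 2 ≡ᵇ 0)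
parity-suc zero          = refl
parity-suc (suc zero)    = refl
parity-suc (suc (suc x)) = parity-suc x

<ᵇ-true : m < n → (m <ᵇ n) ≡ true
<ᵇ-true m<n = dec-true (_ <ℕ? _) m<n

<ᵇ-false : ¬ m < n → (m <ᵇ n) ≡ false
<ᵇ-false m≮n = dec-false (_ <ℕ? _) m≮n

inversions-swap : (a b : Fin n) (u : Vec (Fin n) k) → toℕ a < toℕ b →
                  inversions (b ∷ a ∷ u) ≡ suc (inversions (a ∷ b ∷ u))
inversions-swap a b u a<b rewrite <ᵇ-true a<b | <ᵇ-false (<⇒≯ a<b) =
  cong suc (+.x∙yz≈y∙xz (countSmaller b u) (countSmaller a u) (inversions u))

evenB-swap : (a b : Fin n) (u : Vec (Fin n) k) → toℕ a < toℕ b →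
             evenB (b ∷ a ∷ u) ≡ not (evenB (a ∷ b ∷ u))
evenB-swap a b u a<b =
  trans (cong (λ i → i % 2 ≡ᵇ 0) (inversions-swap a b u a<b)) (parity-suc (inversions (a ∷ b ∷ u)))

distinctB-swap : (a b : Fin n) (u : Vec (Fin n) k) → a ≢ b →
                 distinctB (a ∷ b ∷ u) ≡ distinctB (b ∷ a ∷ u)
distinctB-swap a b u a≢b rewrite ⌊⌋-false (a ≟ b) a≢b | ⌊⌋-false (b ≟ a) (a≢b ∘ sym) =
  ∧.x∙yz≈y∙xz (not (elemB a u)) (not (elemB b u)) (distinctB u)

freshB-swap : (S : Vec (Fin n) m) (a b : Fin n) (u : Vec (Fin n) k) → a ≢ b →
              freshB S (a ∷ b ∷ u) ≡ freshB S (b ∷ a ∷ u)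
freshB-swap S a b u a≢b =
  cong₂ _∧_ (distinctB-swap a b u a≢b) (∧.x∙yz≈y∙xz (not (elemB a S)) (not (elemB b S)) (avoidsB S u))

freshB-repeat : (S : Vec (Fin n) m) (a : Fin n) (u : Vec (Fin n) k) → freshB S (a ∷ a ∷ u) ≡ false
freshB-repeat S a u rewrite ⌊⌋-true (a ≟ a) refl = refl

evenFreshB oddFreshB : Vec (Fin n) m → Vec (Fin n) k → Bool
evenFreshB S w = freshB S w ∧ evenB w
oddFreshB  S w = freshB S w ∧ not (evenB w)

evenFreshB-swap : (S : Vec (Fin n) m) (a b : Fin n) (u : Vec (Fin n) k) →
                  evenFreshB S (a ∷ b ∷ u) ≡ oddFreshB S (b ∷ a ∷ u)
evenFreshB-swap S a b u with <-cmp a b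
... | tri< a<b _ _ = cong₂ _∧_ (freshB-swap S a b u (<⇒≢ a<b))
                               (sym (trans (cong not (evenB-swap a b u a<b)) (not-involutive _)))
... | tri≈ _ refl _ rewrite freshB-repeat S a u = refl
... | tri> _ _ b<a = cong₂ _∧_ (freshB-swap S a b u (<⇒≢ b<a ∘ sym)) (evenB-swap b a u b<a)

count-allVecs-suc² : (p : Vec (Fin n) (2 + k) → Bool) →
                     count p (allVecs n (2 + k)) ≡ ∑[ a < n ] ∑[ b < n ] count (λ u → p (a ∷ b ∷ u)) (allVecs n k)
count-allVecs-suc² p = trans (count-allVecs-suc p) (sum-cong-≗ (λ a → count-allVecs-suc (p ∘ (a ∷_))))

count-evenFreshB≡count-oddFreshB : (S : Vec (Fin n) m) (j : ℕ) →
  count (evenFreshB S) (allVecs n (2 + j)) ≡ count (oddFreshB S) (allVecs n (2 + j))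
count-evenFreshB≡count-oddFreshB {n} S j = begin
  count (evenFreshB S) (allVecs n (2 + j))
    ≡⟨ count-allVecs-suc² (evenFreshB S) ⟩
  ∑[ a < n ] ∑[ b < n ] count (λ u → evenFreshB S (a ∷ b ∷ u)) (allVecs n j)
    ≡⟨ sum-cong-≗ (λ a → sum-cong-≗ (λ b → count-cong (evenFreshB-swap S a b) (allVecs n j))) ⟩
  ∑[ a < n ] ∑[ b < n ] count (λ u → oddFreshB S (b ∷ a ∷ u)) (allVecs n j)
    ≡⟨ ∑-comm (λ a b → count (λ u → oddFreshB S (b ∷ a ∷ u)) (allVecs n j)) ⟩
  ∑[ b < n ] ∑[ a < n ] count (λ u → oddFreshB S (b ∷ a ∷ u)) (allVecs n j)
    ≡⟨ count-allVecs-suc² (oddFreshB S) ⟨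
  count (oddFreshB S) (allVecs n (2 + j)) ∎
  where open ≡-Reasoning

count-evenFreshB : (S : Vec (Fin n) m) → distinctB S ≡ true → (j : ℕ) → m + (2 + j) ≡ n →
                   2 * count (evenFreshB S) (allVecs n (2 + j)) ≡ (2 + j) !
count-evenFreshB {n} S S-distinct j m+2+j≡n = begin
  2 * count (evenFreshB S) tuples
    ≡⟨ cong (count (evenFreshB S) tuples +_) (trans (+-identityʳ _) (count-evenFreshB≡count-oddFreshB S j)) ⟩
  count (evenFreshB S) tuples + count (oddFreshB S) tuples
    ≡⟨ count-∧-not (freshB S) evenB tuples ⟩
  count (freshB S) tuples
    ≡⟨ count-freshB S S-distinct (2 + j) m+2+j≡n ⟩
  (2 + j) ! ∎
  where
  open ≡-Reasoning
  tuples : List (Vec (Fin n) (2 + j))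
  tuples = allVecs n (2 + j)

orderAlt≡count : (n : ℕ) → orderAlt n ≡ count (evenFreshB []) (allVecs n n)
orderAlt≡count n = trans (length-filterᵇ _ (allVecs n n)) (count-cong distinct≡fresh (allVecs n n))
  where
  distinct≡fresh : (v : Vec (Fin n) n) → distinctB v ∧ evenB v ≡ evenFreshB [] v
  distinct≡fresh v = cong (_∧ evenB v) (sym (trans (cong (distinctB v ∧_) (avoidsB-[] v)) (∧-identityʳ _)))

2*orderAlt≡! : (j : ℕ) → 2 * orderAlt (2 + j) ≡ (2 + j) !
2*orderAlt≡! j = trans (cong (2 *_) (orderAlt≡count (2 + j))) (count-evenFreshB [] refl j refl)

elemB-above : {x : Fin n} {w : Vec (Fin n) k} → All (λ y → toℕ x < toℕ y) w → elemB x w ≡ false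
elemB-above []                              = refl
elemB-above {x = x} {y ∷ _} (x<y ∷ x<w) rewrite ⌊⌋-false (x ≟ y) (<⇒≢ x<y) = elemB-above x<w

countSmaller-above : {x : Fin n} {w : Vec (Fin n) k} → All (λ y → toℕ x < toℕ y) w → countSmaller x w ≡ 0
countSmaller-above []          = refl
countSmaller-above (x<y ∷ x<w) rewrite <ᵇ-false (<⇒≯ x<y) = countSmaller-above x<w

Increasing : Vec (Fin n) k → Set
Increasing = AllPairs (λ x y → toℕ x < toℕ y)

distinctB-increasing : {w : Vec (Fin n) k} → Increasing w → distinctB w ≡ true
distinctB-increasing []          = refl
distinctB-increasing (x<w ∷ w↑) rewrite elemB-above x<w = distinctB-increasing w↑

inversions-increasing : {w : Vec (Fin n) k} → Increasing w → inversions w ≡ 0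
inversions-increasing []          = refl
inversions-increasing (x<w ∷ w↑) rewrite countSmaller-above x<w = inversions-increasing w↑

tabulate-increasing : {f : Fin k → Fin n} → (∀ {i j} → toℕ i < toℕ j → toℕ (f i) < toℕ (f j)) →
                      Increasing (Vec.tabulate f)
tabulate-increasing {zero}  f↑ = []
tabulate-increasing {suc k} f↑ = All-tabulate⁺ (λ _ → f↑ z<s) ∷ tabulate-increasing (λ i<j → f↑ (s<s i<j))

-- The 3-cycle (0 1 2) and its centralizer

support : Vec (Fin (3 + k)) 3
support = 0F ∷ 1F ∷ 2F ∷ []

fixedPoints : (k : ℕ) → Vec (Fin (3 + k)) k
fixedPoints k = Vec.tabulate (3 ↑ʳ_)

threeCycle : (k : ℕ) → Vec (Fin (3 + k)) (3 + k)
threeCycle k = 1F ∷ 2F ∷ 0F ∷ fixedPoints k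

-- The images of 0, 1, 2 under the three powers of the 3-cycle.
data Rotation {k : ℕ} : Fin (3 + k) → Fin (3 + k) → Fin (3 + k) → Set where
  rot₀ : Rotation 0F 1F 2F
  rot₁ : Rotation 1F 2F 0F
  rot₂ : Rotation 2F 0F 1F

rotation-≤2 : {a b c : Fin (3 + k)} → Rotation a b c → toℕ a ≤ 2 × toℕ b ≤ 2 × toℕ c ≤ 2
rotation-≤2 rot₀ = z≤n , s≤s z≤n , s≤s (s≤s z≤n)
rotation-≤2 rot₁ = s≤s z≤n , s≤s (s≤s z≤n) , z≤n
rotation-≤2 rot₂ = s≤s (s≤s z≤n) , z≤n , s≤s z≤n

Above2 : Vec (Fin n) j → Set
Above2 = All (λ y → 2 < toℕ y)

above2⇒above : {c : Fin n} {w : Vec (Fin n) j} → toℕ c ≤ 2 → Above2 w → All (λ y → toℕ c < toℕ y) w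
above2⇒above c≤2 = All.map (≤-<-trans c≤2)

avoidsB-support⇒above2 : {w : Vec (Fin (3 + k)) j} → avoidsB support w ≡ true → Above2 w
avoidsB-support⇒above2 {w = []}                      _  = []
avoidsB-support⇒above2 {w = 0F ∷ _}                  ()
avoidsB-support⇒above2 {w = 1F ∷ _}                  ()
avoidsB-support⇒above2 {w = 2F ∷ _}                  ()
avoidsB-support⇒above2 {w = suc (suc (suc _)) ∷ _} av = s≤s (s≤s (s≤s z≤n)) ∷ avoidsB-support⇒above2 av

fixedPoints-above2 : (k : ℕ) → Above2 (fixedPoints k)
fixedPoints-above2 k = All-tabulate⁺ (λ _ → s≤s (s≤s (s≤s z≤n)))

fixedPoints-increasing : (k : ℕ) → Increasing (fixedPoints k)
fixedPoints-increasing k = tabulate-increasing (λ i<j → s<s (s<s (s<s i<j)))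

rotation-even : {a b c : Fin (3 + k)} {w : Vec (Fin (3 + k)) k} → Rotation a b c →
                Above2 w → distinctB w ≡ true → evenB w ≡ true →
                distinctB (a ∷ b ∷ c ∷ w) ∧ evenB (a ∷ b ∷ c ∷ w) ≡ true
rotation-even r w>2 w-distinct w-even
  with a≤2 , b≤2 , c≤2 ← rotation-≤2 r
  rewrite elemB-above (above2⇒above a≤2 w>2) | elemB-above (above2⇒above b≤2 w>2)
        | elemB-above (above2⇒above c≤2 w>2) | countSmaller-above (above2⇒above a≤2 w>2)
        | countSmaller-above (above2⇒above b≤2 w>2) | countSmaller-above (above2⇒above c≤2 w>2)
        | w-distinct
  with r
... | rot₀ = w-even
... | rot₁ = w-even
... | rot₂ = w-even

threeCycle-fixes : {y : Fin (3 + k)} → 2 < toℕ y → lookup (threeCycle k) y ≡ y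
threeCycle-fixes {y = 1F}                (s≤s ())
threeCycle-fixes {y = 2F}                (s≤s (s≤s ()))
threeCycle-fixes {y = suc (suc (suc t))} _ = lookup∘tabulate (3 ↑ʳ_) t

threeCycle-fixes-all : {w : Vec (Fin (3 + k)) j} → Above2 w → Vec.map (lookup (threeCycle k)) w ≡ w
threeCycle-fixes-all []           = refl
threeCycle-fixes-all (y>2 ∷ w>2) = cong₂ _∷_ (threeCycle-fixes y>2) (threeCycle-fixes-all w>2)

lookup-fixedPoints : (a b c : Fin (3 + k)) (w : Vec (Fin (3 + k)) k) →
                     Vec.map (lookup (a ∷ b ∷ c ∷ w)) (fixedPoints k) ≡ w
lookup-fixedPoints a b c w = trans (sym (tabulate-∘ (lookup (a ∷ b ∷ c ∷ w)) (3 ↑ʳ_))) (tabulate∘lookup w)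

rotation-commutes : {a b c : Fin (3 + k)} {w : Vec (Fin (3 + k)) k} → Rotation a b c → Above2 w →
                    threeCycle k ∘ₚ (a ∷ b ∷ c ∷ w) ≡ (a ∷ b ∷ c ∷ w) ∘ₚ threeCycle k
rotation-commutes {a = a} {b} {c} {w} r w>2
  with fixed ← trans (threeCycle-fixes-all w>2) (sym (lookup-fixedPoints a b c w)) | r
... | rot₀ = cong (λ t → 1F ∷ 2F ∷ 0F ∷ t) fixed
... | rot₁ = cong (λ t → 2F ∷ 0F ∷ 1F ∷ t) fixed
... | rot₂ = cong (λ t → 0F ∷ 1F ∷ 2F ∷ t) fixed

centralizerSize≡count : (x : Vec (Fin n) n) →
  centralizerSize x ≡ count (λ v → (distinctB v ∧ evenB v) ∧ commutesB x v) (allVecs n n)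
centralizerSize≡count {n} x =
  trans (length-filterᵇ (commutesB x) (Alt n)) (count-filterᵇ _ (commutesB x) (allVecs n n))

evenArrangements : ℕ → ℕ
evenArrangements k = count (evenFreshB (support {k})) (allVecs (3 + k) k)

2*evenArrangements≡! : (j : ℕ) → 2 * evenArrangements (2 + j) ≡ (2 + j) !
2*evenArrangements≡! j = count-evenFreshB support refl j refl

rotation-centralizes : {a b c : Fin (3 + k)} {w : Vec (Fin (3 + k)) k} → Rotation a b c →
                       evenFreshB support w ≡ true →
                       (distinctB (a ∷ b ∷ c ∷ w) ∧ evenB (a ∷ b ∷ c ∷ w)) ∧ commutesB (threeCycle k) (a ∷ b ∷ c ∷ w) ≡ true
rotation-centralizes {w = w} r w-even-fresh =
  cong₂ _∧_ (rotation-even r w>2 (∧-conicalˡ _ _ w-fresh) (∧-conicalʳ _ _ w-even-fresh))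
            (⌊⌋-true (≡-dec _≟_ _ _) (rotation-commutes r w>2))
  where
  w-fresh : freshB support w ≡ true
  w-fresh = ∧-conicalˡ _ _ w-even-fresh
  w>2 : Above2 w
  w>2 = avoidsB-support⇒above2 (∧-conicalʳ _ _ w-fresh)

3*evenArrangements≤centralizerSize : (k : ℕ) → 3 * evenArrangements k ≤ centralizerSize (threeCycle k)
3*evenArrangements≤centralizerSize k = begin
  3 * e                ≡⟨ cong (λ x → e + (e + x)) (+-identityʳ e) ⟩
  e + (e + e)          ≤⟨ +-mono-≤ (rotation-count rot₀) (+-mono-≤ (rotation-count rot₁) (rotation-count rot₂)) ⟩
  g 0F + (g 1F + g 2F) ≤⟨ +-monoʳ-≤ (g 0F) (+-monoʳ-≤ (g 1F) (m≤m+n (g 2F) _)) ⟩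
  ∑[ a < 3 + k ] g a   ≡⟨ count-allVecs-suc Q ⟨
  count Q (allVecs (3 + k) (3 + k)) ≡⟨ centralizerSize≡count (threeCycle k) ⟨
  centralizerSize (threeCycle k)    ∎
  where
  open ≤-Reasoning
  e : ℕ
  e = evenArrangements k
  Q : Vec (Fin (3 + k)) (3 + k) → Bool
  Q v = (distinctB v ∧ evenB v) ∧ commutesB (threeCycle k) v
  g : Fin (3 + k) → ℕ
  g a = count (λ v → Q (a ∷ v)) (allVecs (3 + k) (2 + k))
  rotation-count : {a b c : Fin (3 + k)} → Rotation a b c → e ≤ g a
  rotation-count {a} {b} {c} r = begin
    e                                                     ≤⟨ count-mono (λ _ → rotation-centralizes r) (allVecs (3 + k) k) ⟩
    count (λ w → Q (a ∷ b ∷ c ∷ w)) (allVecs (3 + k) k)   ≤⟨ count-allVecs-head (λ w → Q (a ∷ b ∷ w)) c ⟩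
    count (λ w → Q (a ∷ b ∷ w)) (allVecs (3 + k) (1 + k)) ≤⟨ count-allVecs-head (λ w → Q (a ∷ w)) b ⟩
    g a                                                   ∎

threeCycle∈Alt : (k : ℕ) → threeCycle k ∈ Alt (3 + k)
threeCycle∈Alt k = ∈-filter⁺ (T? ∘ λ v → distinctB v ∧ evenB v) (∈-allVecs (threeCycle k))
  (Equivalence.from T-≡ (rotation-even rot₁ (fixedPoints-above2 k) distinct even))
  where
  distinct : distinctB (fixedPoints k) ≡ true
  distinct = distinctB-increasing (fixedPoints-increasing k)
  even : evenB (fixedPoints k) ≡ true
  even = cong (λ i → i % 2 ≡ᵇ 0) (inversions-increasing (fixedPoints-increasing k))

threeCycle≢idPerm : (k : ℕ) → threeCycle k ≢ idPerm (3 + k)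
threeCycle≢idPerm k ()

factorial-P3 : (k : ℕ) → (3 + k) ! ≡ ((3 + k) P 3) * k !
factorial-P3 k = expand k (k !)
  where
  expand : ∀ k f → (3 + k) * ((2 + k) * ((1 + k) * f)) ≡ (1 + k) * ((2 + k) * ((3 + k) * 1)) * f
  expand = solve-∀

orderAlt≡P3*evenArrangements : (j : ℕ) → orderAlt (5 + j) ≡ ((5 + j) P 3) * evenArrangements (2 + j)
orderAlt≡P3*evenArrangements j = *-cancelˡ-≡ _ _ 2 (begin
  2 * orderAlt (5 + j) ≡⟨ 2*orderAlt≡! (3 + j) ⟩
  (5 + j) !            ≡⟨ factorial-P3 (2 + j) ⟩
  t * (2 + j) !        ≡⟨ cong (t *_) (2*evenArrangements≡! j) ⟨
  t * (2 * e)          ≡⟨ *.x∙yz≈y∙xz t 2 e ⟩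
  2 * (t * e)          ∎)
  where
  open ≡-Reasoning
  t e : ℕ
  t = (5 + j) P 3
  e = evenArrangements (2 + j)

-- Growth estimates

ratio-induction : (g h : ℕ → ℕ) (k₀ : ℕ) →
                  (∀ k → k₀ ≤ k → g (suc k) ≤ suc k * g k) → (∀ k → suc k * h k ≤ h (suc k)) →
                  g k₀ < h k₀ → ∀ k → k₀ ≤ k → g k < h k
ratio-induction g h k₀ g-step h-step base k k₀≤k = go (≤⇒≤′ k₀≤k)
  where
  go : ∀ {k} → k₀ ≤′ k → g k < h k
  go (≤′-reflexive refl)      = base
  go {suc k} (≤′-step k₀≤′k) = begin-strict
    g (suc k)   ≤⟨ g-step k (≤′⇒≤ k₀≤′k) ⟩
    suc k * g k <⟨ *-monoʳ-< (suc k) (go k₀≤′k) ⟩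
    suc k * h k ≤⟨ h-step k ⟩
    h (suc k)   ∎
    where open ≤-Reasoning

scale-ratio : (c m : ℕ) {x y : ℕ} → x ≤ m * y → c * x ≤ m * (c * y)
scale-ratio c m {y = y} x≤my = ≤-trans (*-monoʳ-≤ c x≤my) (≤-reflexive (*.x∙yz≈y∙xz c m y))

factorial-ratio : (c k : ℕ) → suc k * (c * k !) ≤ c * (suc k) !
factorial-ratio c k = ≤-reflexive (*.x∙yz≈y∙xz (suc k) c (k !))

factorial³-ratio : (c k : ℕ) → suc k * (c * (k !) ^ 3) ≤ c * ((suc k) !) ^ 3
factorial³-ratio c k = ≤-trans (m≤m*n _ (suc k * suc k)) (≤-reflexive (sym (expand c (suc k) (k !))))
  where
  expand : ∀ c s f → c * ((s * f) * ((s * f) * ((s * f) * 1))) ≡ s * (c * (f * (f * (f * 1)))) * (s * s)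
  expand = solve-∀

P3-ratio : (k : ℕ) → 2 ≤ k → (4 + k) P 3 ≤ suc k * ((3 + k) P 3)
P3-ratio (suc (suc i)) (s≤s (s≤s z≤n)) = begin
  (6 + i) P 3               ≡⟨ lhs i ⟩
  (6 + i) * mid             ≤⟨ *-monoˡ-≤ mid (≤-trans (m≤m+n (6 + i) (3 + 5 * i + i * i)) (≤-reflexive (square i))) ⟩
  ((3 + i) * (3 + i)) * mid ≡⟨ rhs i ⟩
  (3 + i) * ((5 + i) P 3)   ∎
  where
  open ≤-Reasoning
  mid : ℕ
  mid = (4 + i) * (5 + i)
  lhs : ∀ i → (4 + i) * ((5 + i) * ((6 + i) * 1)) ≡ (6 + i) * ((4 + i) * (5 + i))
  lhs = solve-∀
  square : ∀ i → 6 + i + (3 + 5 * i + i * i) ≡ (3 + i) * (3 + i)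
  square = solve-∀
  rhs : ∀ i → ((3 + i) * (3 + i)) * ((4 + i) * (5 + i)) ≡ (3 + i) * ((3 + i) * ((4 + i) * ((5 + i) * 1)))
  rhs = solve-∀

P3³-ratio : (k : ℕ) → 4 ≤ k → ((4 + k) P 3) ^ 3 ≤ suc k * ((3 + k) P 3) ^ 3
P3³-ratio (suc (suc (suc (suc i)))) (s≤s (s≤s (s≤s (s≤s z≤n)))) = begin
  ((8 + i) P 3) ^ 3       ≡⟨ lhs i ⟩
  (8 + i) ^ 3 * mid ^ 3   ≤⟨ *-monoˡ-≤ (mid ^ 3) (≤-trans (m≤m+n ((8 + i) ^ 3) rest) (≤-reflexive (quartic i))) ⟩
  (5 + i) ^ 4 * mid ^ 3   ≡⟨ rhs i ⟩
  (5 + i) * ((7 + i) P 3) ^ 3 ∎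
  where
  open ≤-Reasoning
  mid rest : ℕ
  mid = (6 + i) * (7 + i)
  rest = 113 + 308 * i + 126 * (i * i) + 19 * (i * (i * i)) + i * (i * (i * i))
  lhs : ∀ i → let p = (6 + i) * ((7 + i) * ((8 + i) * 1)); q = (6 + i) * (7 + i) in
        p * (p * (p * 1)) ≡ ((8 + i) * ((8 + i) * ((8 + i) * 1))) * (q * (q * (q * 1)))
  lhs = solve-∀
  quartic : ∀ i → (8 + i) * ((8 + i) * ((8 + i) * 1))
                    + (113 + 308 * i + 126 * (i * i) + 19 * (i * (i * i)) + i * (i * (i * i)))
                  ≡ (5 + i) * ((5 + i) * ((5 + i) * ((5 + i) * 1)))
  quartic = solve-∀
  rhs : ∀ i → let p = (5 + i) * ((6 + i) * ((7 + i) * 1)); q = (6 + i) * (7 + i) in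
        ((5 + i) * ((5 + i) * ((5 + i) * ((5 + i) * 1)))) * (q * (q * (q * 1))) ≡ (5 + i) * (p * (p * (p * 1)))
  rhs = solve-∀

P3³-below-factorial : (k : ℕ) → 13 ≤ k → 2 * ((3 + k) P 3) ^ 3 < 81 * k !
P3³-below-factorial = ratio-induction (λ k → 2 * ((3 + k) P 3) ^ 3) (λ k → 81 * k !) 13
  (λ k 13≤k → scale-ratio 2 (suc k) (P3³-ratio k (≤-trans (s≤s (s≤s (s≤s (s≤s z≤n)))) 13≤k)))
  (factorial-ratio 81) (<ᵇ⇒< _ _ _)

P3-below-factorial : (k : ℕ) → 5 ≤ k → 2 * ((3 + k) P 3) < 9 * k !
P3-below-factorial = ratio-induction (λ k → 2 * ((3 + k) P 3)) (λ k → 9 * k !) 5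
  (λ k 5≤k → scale-ratio 2 (suc k) (P3-ratio k (≤-trans (s≤s (s≤s z≤n)) 5≤k)))
  (factorial-ratio 9) (<ᵇ⇒< _ _ _)

P3-below-factorial³ : (k : ℕ) → 2 ≤ k → 8 * ((3 + k) P 3) < 81 * (k !) ^ 3
P3-below-factorial³ = ratio-induction (λ k → 8 * ((3 + k) P 3)) (λ k → 81 * (k !) ^ 3) 2
  (λ k 2≤k → scale-ratio 8 (suc k) (P3-ratio k 2≤k))
  (factorial³-ratio 81) (<ᵇ⇒< _ _ _)

evenArrangements≢0 : (j : ℕ) → NonZero (evenArrangements (2 + j))
evenArrangements≢0 j = m*n≢0⇒n≢0 2 {{subst NonZero (sym (2*evenArrangements≡! j)) ((2 + j) !≢0)}}

module _ (t e : ℕ) .{{_ : NonZero e}} {f : ℕ} (2e≡f : 2 * e ≡ f) where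
  open ≤-Reasoning

  [t*e]^3<[3*e]^4 : 2 * t ^ 3 < 81 * f → (t * e) ^ 3 < (3 * e) ^ 4
  [t*e]^3<[3*e]^4 2t³<81f = begin-strict
    (t * e) ^ 3          ≡⟨ lhs t e ⟩
    t ^ 3 * e ^ 3        <⟨ *-monoˡ-< (e ^ 3) {{m^n≢0 e 3}} t³<81e ⟩
    (81 * e) * e ^ 3     ≡⟨ rhs e ⟩
    (3 * e) ^ 4          ∎
    where
    t³<81e : t ^ 3 < 81 * e
    t³<81e = *-cancelˡ-< 2 _ _ (subst (2 * t ^ 3 <_) (trans (cong (81 *_) (sym 2e≡f)) (*.x∙yz≈y∙xz 81 2 e)) 2t³<81f)
    lhs : ∀ t e → (t * e) * ((t * e) * ((t * e) * 1)) ≡ (t * (t * (t * 1))) * (e * (e * (e * 1)))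
    lhs = solve-∀
    rhs : ∀ e → (81 * e) * (e * (e * (e * 1))) ≡ (3 * e) * ((3 * e) * ((3 * e) * ((3 * e) * 1)))
    rhs = solve-∀

  t*e<[3*e]^2 : 2 * t < 9 * f → t * e < (3 * e) ^ 2
  t*e<[3*e]^2 2t<9f = begin-strict
    t * e         <⟨ *-monoˡ-< e t<9e ⟩
    (9 * e) * e   ≡⟨ rhs e ⟩
    (3 * e) ^ 2   ∎
    where
    t<9e : t < 9 * e
    t<9e = *-cancelˡ-< 2 _ _ (subst (2 * t <_) (trans (cong (9 *_) (sym 2e≡f)) (*.x∙yz≈y∙xz 9 2 e)) 2t<9f)
    rhs : ∀ e → (9 * e) * e ≡ (3 * e) * ((3 * e) * 1)
    rhs = solve-∀

  t*e<[3*e]^4 : 8 * t < 81 * f ^ 3 → t * e < (3 * e) ^ 4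
  t*e<[3*e]^4 8t<81f³ = begin-strict
    t * e               <⟨ *-monoˡ-< e t<81e³ ⟩
    (81 * e ^ 3) * e    ≡⟨ rhs e ⟩
    (3 * e) ^ 4         ∎
    where
    cube : ∀ e → 81 * ((2 * e) * ((2 * e) * ((2 * e) * 1))) ≡ 8 * (81 * (e * (e * (e * 1))))
    cube = solve-∀
    t<81e³ : t < 81 * e ^ 3
    t<81e³ = *-cancelˡ-< 8 _ _ (subst (8 * t <_) (trans (cong (λ f → 81 * f ^ 3) (sym 2e≡f)) (cube e)) 8t<81f³)
    rhs : ∀ e → (81 * (e * (e * (e * 1)))) * e ≡ (3 * e) * ((3 * e) * ((3 * e) * ((3 * e) * 1)))
    rhs = solve-∀

lemma5p4 : (n : ℕ) → 5 ≤ n →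
    (16 ≤ n → ∃[ x ] (x ∈ Alt n × x ≢ idPerm n × orderAlt n ^ 3 < centralizerSize x ^ 4))
    × (8 ≤ n → ∃[ x ] (x ∈ Alt n × x ≢ idPerm n × orderAlt n < centralizerSize x ^ 2))
    × (∃[ x ] (x ∈ Alt n × x ≢ idPerm n × orderAlt n < centralizerSize x ^ 4))
lemma5p4 n@(suc (suc (suc k@(suc (suc j))))) (s≤s (s≤s (s≤s (s≤s (s≤s z≤n))))) =
    (λ { (s≤s (s≤s (s≤s 13≤k))) → witness (begin-strict
      orderAlt n ^ 3 ≡⟨ cong (_^ 3) (orderAlt≡P3*evenArrangements j) ⟩
      (t * e) ^ 3    <⟨ [t*e]^3<[3*e]^4 t e (2*evenArrangements≡! j) (P3³-below-factorial k 13≤k) ⟩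
      (3 * e) ^ 4    ≤⟨ ^-monoˡ-≤ 4 (3*evenArrangements≤centralizerSize k) ⟩
      C ^ 4          ∎) })
  , (λ { (s≤s (s≤s (s≤s 5≤k))) → witness (begin-strict
      orderAlt n  ≡⟨ orderAlt≡P3*evenArrangements j ⟩
      t * e       <⟨ t*e<[3*e]^2 t e (2*evenArrangements≡! j) (P3-below-factorial k 5≤k) ⟩
      (3 * e) ^ 2 ≤⟨ ^-monoˡ-≤ 2 (3*evenArrangements≤centralizerSize k) ⟩
      C ^ 2       ∎) })
  , witness (begin-strict
      orderAlt n  ≡⟨ orderAlt≡P3*evenArrangements j ⟩
      t * e       <⟨ t*e<[3*e]^4 t e (2*evenArrangements≡! j) (P3-below-factorial³ k (s≤s (s≤s z≤n))) ⟩
      (3 * e) ^ 4 ≤⟨ ^-monoˡ-≤ 4 (3*evenArrangements≤centralizerSize k) ⟩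
      C ^ 4       ∎)
  where
  open ≤-Reasoning
  instance _ = evenArrangements≢0 j
  t e C : ℕ
  t = n P 3
  e = evenArrangements k
  C = centralizerSize (threeCycle k)
  witness : {P : Vec (Fin n) n → Set} → P (threeCycle k) → ∃[ x ] (x ∈ Alt n × x ≢ idPerm n × P x)
  witness p = threeCycle k , threeCycle∈Alt k , threeCycle≢idPerm k , p
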